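{- For integers $n\ge k\ge 0$, let $\mathcal{P}_a(n,k)$ be the set of grounded partitions in $\mathcal{P}_{2,a}$ of weight $n$ having exactly $k$ odd parts, and let $\mathcal{E}(n,k)$ be the set of (ordinary) partitions of $n$ having exactly $k$ odd parts (counted with multiplicity) and in which all even parts are distinct. Then there is a bijection between $\mathcal{P}_a(n,k)$ and $\mathcal{E}(n,k)$; in particular $|\mathcal{P}_a(n,k)|=|\mathcal{E}(n,k)|$.
   Context: Colours are $a,b,c$ (indexed $c_0=a$, $c_1=b$, $c_2=c$). A grounded partition in $\mathcal{P}_{2,a}$ is a finite (possibly empty) sequence $(\lambda_1,\dots,\lambda_\ell)$ of positive integers, each carrying a colour in $\{a,b,c\}$, such that, setting $\lambda_0=0$ with colour $a$ (the ground), for every $0\le j<\ell$, if $\lambda_j$ has colour $c_p$ and $\lambda_{j+1}$ has colour $c_r$, then $\lambda_{j+1}-\lambda_j=|2-p-r|$. (Thus the required differences are: $a\to a$: 2, $a\to b$: 1, $a\to c$: 0, $b\to a$: 1, $b\to b$: 0, $b\to c$: 1, $c\to a$: 0, $c\to b$: 1, $c\to c$: 2.) Its weight is $\lambda_1+\cdots+\lambda_\ell$, and odd parts are counted with multiplicity. -}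

module Defs where

open import Data.Nat using (ℕ; zero; suc; _+_; ∣_-_∣; _≡ᵇ_; _≤ᵇ_; _<ᵇ_)
open import Data.Bool using (Bool; true; false; _∧_; not)
open import Data.List using (List; []; _∷_; map)
open import Data.Nat.ListAction using (sum)
open import Data.Product using (Σ; _×_; _,_; proj₁; proj₂)
open import Relation.Binary.PropositionalEquality using (_≡_)

data Colour : Set where
  a b c : Colour

index : Colour → ℕ
index a = 0
index b = 1
index c = 2

-- required difference when colour p is followed by colour r : |2 - p - r|
diff : Colour → Colour → ℕ
diff p r = ∣ 2 - (index p + index r) ∣

isOdd : ℕ → Bool
isOdd zero = false
isOdd (suc n) = not (isOdd n)

isEven : ℕ → Bool
isEven n = not (isOdd n)

countOdd : List ℕ → ℕ
countOdd [] = 0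
countOdd (x ∷ xs) with isOdd x
... | true  = suc (countOdd xs)
... | false = countOdd xs

CPart : Set
CPart = ℕ × Colour

groundedFrom : ℕ → Colour → List CPart → Bool
groundedFrom v p [] = true
groundedFrom v p ((x , r) ∷ xs) =
  (1 ≤ᵇ x) ∧ ((x ≡ᵇ (v + diff p r)) ∧ groundedFrom x r xs)

-- ground λ₀ = 0 with colour a
isGrounded : List CPart → Bool
isGrounded = groundedFrom 0 a

sizes : List CPart → List ℕ
sizes = map proj₁

Pa : ℕ → ℕ → Set
Pa n k = Σ (List CPart) λ π →
  (isGrounded π ≡ true) × (sum (sizes π) ≡ n) × (countOdd (sizes π) ≡ k)

allPositive : List ℕ → Bool
allPositive [] = true
allPositive (x ∷ xs) = (1 ≤ᵇ x) ∧ allPositive xs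

nonIncreasing : List ℕ → Bool
nonIncreasing [] = true
nonIncreasing (x ∷ []) = true
nonIncreasing (x ∷ y ∷ xs) = (y ≤ᵇ x) ∧ nonIncreasing (y ∷ xs)

isPartition : List ℕ → Bool
isPartition xs = allPositive xs ∧ nonIncreasing xs

occurs : ℕ → List ℕ → Bool
occurs x [] = false
occurs x (y ∷ ys) with x ≡ᵇ y
... | true  = true
... | false = occurs x ys

evenDistinct : List ℕ → Bool
evenDistinct [] = true
evenDistinct (x ∷ xs) with isEven x
... | true  = not (occurs x xs) ∧ evenDistinct xs
... | false = evenDistinct xs

E : ℕ → ℕ → Set
E n k = Σ (List ℕ) λ μ →
  (isPartition μ ≡ true) × (evenDistinct μ ≡ true) ×
  (sum μ ≡ n) × (countOdd μ ≡ k)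

-- Read a grounded partition level by level. Above an even level v whose last part has
-- the outer colour ρ ∈ {a, c}, it consists of some parts v+1 of colour b, then possibly a run of parts
-- v+2 whose colours alternate between a and c, starting with ρ or, after at least one b-part, with the
-- other outer colour; since consecutive colours determine the sizes, this data (a `Code`) determines
-- the partition. Let e be the number of even parts above the run. A run of length L+1 that keeps the
-- colour ρ becomes the even part 2(L+1+e); one that switches becomes the odd part 2(L+1+e)+v+1 and
-- uses up one b-part; every other b-part becomes the odd part v+1. Merging these even and odd parts
-- gives a partition with distinct even parts, of the same weight and with the same number of odd
-- parts. It can be decoded again: the lowest run keeps its colour exactly when the largest even part d
-- and the largest odd part o satisfy o ≤ d + v + 1, the run length is recovered from d or o, and the
-- remaining parts encode the rest of the partition.
module Submission where

open import Defs
open import Data.Nat using (ℕ; zero; suc; _+_; _*_; _∸_; _≤_; _<_; z≤n; s≤s; _≤ᵇ_; _≡ᵇ_)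
open import Data.Nat.Properties
open import Data.Nat.ListAction using (sum)
open import Data.Nat.ListAction.Properties using (sum-++; sum-↭)
open import Data.Nat.Tactic.RingSolver using (solve-∀)
open import Data.Bool using (Bool; true; false; not; _∧_; _xor_; T)
import Data.Bool as Bool
open import Data.Bool.Properties
  using (xor-same; not-distribˡ-xor; not-involutive; not-injective; not-¬; T-≡; T-∧; ∧-conicalˡ; ∧-conicalʳ)
open import Data.Empty using (⊥; ⊥-elim)
open import Data.Product using (Σ; ∃-syntax; _×_; _,_; proj₁; proj₂; map₁; uncurry)
open import Data.List using (List; []; _∷_; _++_; replicate; map; length; filterᵇ; merge)
open import Data.List.Properties
  using (map-++; map-replicate; ++-identityʳ; length-replicate; length-++; length-++-≤ˡ;
         ∷-injectiveˡ; ∷-injectiveʳ; filter-accept; filter-reject)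
open import Data.List.Relation.Unary.All as All using (All; []; _∷_)
open import Data.List.Relation.Unary.All.Properties using (++⁺; ++⁻ˡ; filter⁺)
open import Data.List.Relation.Binary.Permutation.Propositional using (↭-sym)
open import Data.List.Relation.Binary.Permutation.Propositional.Properties using (merge-↭; All-resp-↭)
open import Function using (_∘_)
open import Function.Bundles using (Equivalence; _⇔_; _↔_; mk↔ₛ′; mk⇔)
open import Function.Definitions using (Injective)
open import Function.Properties.Inverse using (↔-sym; ↔-trans)
open import Relation.Nullary using (¬_; yes; no; Irrelevant)
open import Relation.Nullary.Decidable using (T?)
open import Relation.Binary using (Decidable)
open import Relation.Binary.PropositionalEquality
open import Axiom.UniquenessOfIdentityProofs using (module Decidable⇒UIP)


true⇒T : ∀ {b} → b ≡ true → T b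
true⇒T refl = _

false⇒¬T : ∀ {b} → b ≡ false → ¬ T b
false⇒¬T refl ()

true⇒≢false : ∀ {b} → b ≡ true → b ≢ false
true⇒≢false refl ()

≤⇒≤ᵇ≡true : ∀ {m n} → m ≤ n → (m ≤ᵇ n) ≡ true
≤⇒≤ᵇ≡true = Equivalence.to T-≡ ∘ ≤⇒≤ᵇ

≰⇒≤ᵇ≡false : ∀ {m n} → ¬ m ≤ n → (m ≤ᵇ n) ≡ false
≰⇒≤ᵇ≡false {m} {n} m≰n with m ≤ᵇ n in eq
... | true  = ⊥-elim (m≰n (≤ᵇ⇒≤ m n (true⇒T eq)))
... | false = refl

isOdd-+ : ∀ m n → isOdd (m + n) ≡ isOdd m xor isOdd n
isOdd-+ zero    n = refl
isOdd-+ (suc m) n rewrite isOdd-+ m n = not-distribˡ-xor (isOdd m) (isOdd n)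

isOdd-2* : ∀ n → isOdd (2 * n) ≡ false
isOdd-2* n rewrite isOdd-+ n (n + 0) | +-identityʳ n = xor-same (isOdd n)

isOdd-2*+ : ∀ h n → isOdd (2 * h + n) ≡ isOdd n
isOdd-2*+ h n rewrite isOdd-+ (2 * h) n | isOdd-2* h = refl

isOdd-2+ : ∀ n → isOdd (2 + n) ≡ isOdd n
isOdd-2+ n = not-involutive (isOdd n)

half : ∀ m → isOdd m ≡ false → ∃[ h ] m ≡ 2 * h
half zero             _ = 0 , refl
half (suc zero)       ()
half (suc (suc m)) eq with half m (trans (sym (not-involutive (isOdd m))) eq)
... | h , refl = suc h , sym (*-suc 2 h)

half-difference : ∀ {m n} → isOdd m ≡ isOdd n → n ≤ m → ∃[ h ] m ≡ 2 * h + n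
half-difference {m} {zero} par _ with half m par
... | h , eq = h , trans eq (sym (+-identityʳ (2 * h)))
half-difference {suc m} {suc n} par (s≤s n≤m) with half-difference (not-injective par) n≤m
... | h , eq = h , trans (cong suc eq) (sym (+-suc (2 * h) n))

odd-gap : ∀ {x y} → isOdd x ≡ isOdd y → y ≤ x → y ≢ x → 2 + y ≤ x
odd-gap par y≤x y≢x = ≤∧≢⇒< (≤∧≢⇒< y≤x y≢x) λ { refl → not-¬ refl (sym par) }

odd≢even : ∀ {x y} → isOdd x ≡ true → isOdd y ≡ false → x ≢ y
odd≢even odd even refl = true⇒≢false odd even


All-replicate : ∀ {X : Set} {P : X → Set} {x} n → P x → All P (replicate n x)
All-replicate zero    _  = []
All-replicate (suc n) px = px ∷ All-replicate n px

sum-replicate : ∀ n x → sum (replicate n x) ≡ n * x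
sum-replicate zero    x = refl
sum-replicate (suc n) x = cong (x +_) (sum-replicate n x)

sum-++-replicate : ∀ xs j x → sum (xs ++ replicate j x) ≡ sum xs + j * x
sum-++-replicate xs j x = trans (sum-++ xs (replicate j x)) (cong (sum xs +_) (sum-replicate j x))

length-++-replicate : ∀ (xs : List ℕ) j x → j + length xs ≡ length (xs ++ replicate j x)
length-++-replicate xs j x = begin
  j + length xs                          ≡⟨ +-comm j (length xs) ⟩
  length xs + j                          ≡⟨ cong (length xs +_) (length-replicate j) ⟨
  length xs + length (replicate j x)     ≡⟨ length-++ xs ⟨
  length (xs ++ replicate j x)           ∎
  where open ≡-Reasoning

replicate-injective : ∀ {X : Set} {x : X} j j′ → replicate j x ≡ replicate j′ x → j ≡ j′
replicate-injective j j′ eq = trans (sym (length-replicate j)) (trans (cong length eq) (length-replicate j′))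

++-replicate-injective : ∀ {u} xs xs′ j j′ → All (u <_) xs → All (u <_) xs′ →
  xs ++ replicate j u ≡ xs′ ++ replicate j′ u → xs ≡ xs′ × j ≡ j′
++-replicate-injective []       []         j j′       _           _            eq = refl , replicate-injective j j′ eq
++-replicate-injective []       (x′ ∷ xs′) (suc j) j′ _           (u<x′ ∷ _) eq =
  ⊥-elim (<-irrefl (∷-injectiveˡ eq) u<x′)
++-replicate-injective (x ∷ xs) []         j (suc j′) (u<x ∷ _) _            eq =
  ⊥-elim (<-irrefl (sym (∷-injectiveˡ eq)) u<x)
++-replicate-injective (x ∷ xs) (x′ ∷ xs′) j j′       (_ ∷ us)   (_ ∷ us′)   eq
  with refl ← ∷-injectiveˡ eq
  with refl , j≡j′ ← ++-replicate-injective xs xs′ j j′ us us′ (∷-injectiveʳ eq) = refl , j≡j′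

All-≤-≥⇒replicate : ∀ {u} xs → All (_≤ u) xs → All (u ≤_) xs → xs ≡ replicate (length xs) u
All-≤-≥⇒replicate []       []         []         = refl
All-≤-≥⇒replicate (x ∷ xs) (x≤ ∷ ≤xs) (≤x ∷ xs≤) = cong₂ _∷_ (≤-antisym x≤ ≤x) (All-≤-≥⇒replicate xs ≤xs xs≤)

countOdd-++ : ∀ xs ys → countOdd (xs ++ ys) ≡ countOdd xs + countOdd ys
countOdd-++ []       ys = refl
countOdd-++ (x ∷ xs) ys with isOdd x
... | true  = cong suc (countOdd-++ xs ys)
... | false = countOdd-++ xs ys

countOdd-replicate-odd : ∀ {x} n → isOdd x ≡ true → countOdd (replicate n x) ≡ n
countOdd-replicate-odd zero    _ = refl
countOdd-replicate-odd (suc n) o rewrite o = cong suc (countOdd-replicate-odd n o)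

countOdd-replicate-even : ∀ {x} n → isOdd x ≡ false → countOdd (replicate n x) ≡ 0
countOdd-replicate-even zero    _ = refl
countOdd-replicate-even (suc n) e rewrite e = countOdd-replicate-even n e

countOdd≡length-filter : ∀ xs → countOdd xs ≡ length (filterᵇ isOdd xs)
countOdd≡length-filter []       = refl
countOdd≡length-filter (x ∷ xs) with isOdd x
... | true  = cong suc (countOdd≡length-filter xs)
... | false = countOdd≡length-filter xs

filterᵇ-all : ∀ {X : Set} (p : X → Bool) {xs} → All (λ x → p x ≡ true) xs → filterᵇ p xs ≡ xs
filterᵇ-all p []                = refl
filterᵇ-all p (_∷_ {x} px pxs) rewrite px = cong (x ∷_) (filterᵇ-all p pxs)

filterᵇ-none : ∀ {X : Set} (p : X → Bool) {xs} → All (λ x → p x ≡ false) xs → filterᵇ p xs ≡ []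
filterᵇ-none p []              = refl
filterᵇ-none p (_∷_ {x} px pxs) rewrite px = filterᵇ-none p pxs

merge-[]ʳ : ∀ {X : Set} {R : X → X → Set} (R? : Decidable R) xs → merge R? xs [] ≡ xs
merge-[]ʳ R? []      = refl
merge-[]ʳ R? (_ ∷ _) = refl

All-merge : ∀ {X : Set} {P : X → Set} {R : X → X → Set} (R? : Decidable R) {xs ys} →
  All P xs → All P ys → All P (merge R? xs ys)
All-merge R? {xs} {ys} pxs pys = All-resp-↭ (↭-sym (merge-↭ R? xs ys)) (++⁺ pxs pys)

sum-merge : ∀ {R : ℕ → ℕ → Set} (R? : Decidable R) xs ys → sum (merge R? xs ys) ≡ sum xs + sum ys
sum-merge R? xs ys = trans (sum-↭ (merge-↭ R? xs ys)) (sum-++ xs ys)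

filterᵇ-merge-left : ∀ {X : Set} (p : X → Bool) {R : X → X → Set} (R? : Decidable R) xs ys →
  All (λ x → p x ≡ true) xs → All (λ y → p y ≡ false) ys → filterᵇ p (merge R? xs ys) ≡ xs
filterᵇ-merge-left p R? []       ys       _   pys = filterᵇ-none p pys
filterᵇ-merge-left p R? (x ∷ xs) []       pxs _   = filterᵇ-all p pxs
filterᵇ-merge-left p R? (x ∷ xs) (y ∷ ys) (px ∷ pxs) (py ∷ pys)
  with R? x y | filterᵇ-merge-left p R? xs (y ∷ ys) pxs (py ∷ pys)
             | filterᵇ-merge-left p R? (x ∷ xs) ys (px ∷ pxs) pys
... | yes _ | ih | _  = trans (filter-accept (T? ∘ p) (true⇒T px)) (cong (x ∷_) ih)
... | no _  | _  | ih = trans (filter-reject (T? ∘ p) (false⇒¬T py)) ih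

filterᵇ-merge-right : ∀ {X : Set} (p : X → Bool) {R : X → X → Set} (R? : Decidable R) xs ys →
  All (λ x → p x ≡ false) xs → All (λ y → p y ≡ true) ys → filterᵇ p (merge R? xs ys) ≡ ys
filterᵇ-merge-right p R? []       ys       _   pys = filterᵇ-all p pys
filterᵇ-merge-right p R? (x ∷ xs) []       pxs _   = filterᵇ-none p pxs
filterᵇ-merge-right p R? (x ∷ xs) (y ∷ ys) (px ∷ pxs) (py ∷ pys)
  with R? x y | filterᵇ-merge-right p R? xs (y ∷ ys) pxs (py ∷ pys)
             | filterᵇ-merge-right p R? (x ∷ xs) ys (px ∷ pxs) pys
... | yes _ | ih | _  = trans (filter-reject (T? ∘ p) (false⇒¬T px)) ih
... | no _  | _  | ih = trans (filter-accept (T? ∘ p) (true⇒T py)) (cong (y ∷_) ih)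

merge-≥ : ∀ {x y} xs ys → y ≤ x → merge _≥?_ (x ∷ xs) (y ∷ ys) ≡ x ∷ merge _≥?_ xs (y ∷ ys)
merge-≥ xs ys y≤x rewrite ≤⇒≤ᵇ≡true y≤x = refl

merge-< : ∀ {x y} xs ys → x < y → merge _≥?_ (x ∷ xs) (y ∷ ys) ≡ y ∷ merge _≥?_ (x ∷ xs) ys
merge-< xs ys x<y rewrite ≰⇒≤ᵇ≡false (<⇒≱ x<y) = refl

merge-≥-all : ∀ {x} xs ys → All (_≤ x) ys → merge _≥?_ (x ∷ xs) ys ≡ x ∷ merge _≥?_ xs ys
merge-≥-all xs []       []        = cong (_ ∷_) (sym (merge-[]ʳ _≥?_ xs))
merge-≥-all xs (y ∷ ys) (y≤x ∷ _) = merge-≥ xs ys y≤x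

merge-<-all : ∀ {y} xs ys → All (_< y) xs → merge _≥?_ xs (y ∷ ys) ≡ y ∷ merge _≥?_ xs ys
merge-<-all []       ys []        = refl
merge-<-all (x ∷ xs) ys (x<y ∷ _) = merge-< xs ys x<y


Σ-≡ : ∀ {X : Set} {P : X → Set} → (∀ {x} → Irrelevant (P x)) →
      ∀ {x x′ p p′} → x ≡ x′ → _≡_ {A = Σ X P} (x , p) (x′ , p′)
Σ-≡ irr {p = p} {p′} refl = cong (_ ,_) (irr p p′)

×-irrelevant : ∀ {S T : Set} → Irrelevant S → Irrelevant T → Irrelevant (S × T)
×-irrelevant S-irrelevant T-irrelevant (s , t) (s′ , t′) = cong₂ _,_ (S-irrelevant s s′) (T-irrelevant t t′)

Bool-≡-irrelevant : ∀ {x y : Bool} → Irrelevant (x ≡ y)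
Bool-≡-irrelevant = Decidable⇒UIP.≡-irrelevant Bool._≟_

image-↔ : ∀ {C X : Set} {P : X → Set} (f : C → X) → Injective _≡_ _≡_ f → (∀ {x} → Irrelevant (P x)) →
  (∀ {x} → P x → ∃[ κ ] f κ ≡ x) → Σ C (P ∘ f) ↔ Σ X P
image-↔ {P = P} f f-injective P-irrelevant onto = mk↔ₛ′ (λ (κ , p) → f κ , p) from
  (λ (x , p) → Σ-≡ P-irrelevant (proj₂ (onto p)))
  (λ (κ , p) → Σ-≡ P-irrelevant (f-injective (proj₂ (onto p))))
  where
  from : Σ _ P → Σ _ (P ∘ f)
  from (x , p) = proj₁ (onto p) , subst P (sym (proj₂ (onto p))) p

Σ-⇔-↔ : ∀ {C : Set} {P Q : C → Set} → (∀ {κ} → Irrelevant (P κ)) → (∀ {κ} → Irrelevant (Q κ)) →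
  (∀ κ → P κ ⇔ Q κ) → Σ C P ↔ Σ C Q
Σ-⇔-↔ P-irrelevant Q-irrelevant P⇔Q =
  mk↔ₛ′ (λ (κ , p) → κ , Equivalence.to (P⇔Q κ) p) (λ (κ , q) → κ , Equivalence.from (P⇔Q κ) q)
        (λ _ → Σ-≡ Q-irrelevant refl) (λ _ → Σ-≡ P-irrelevant refl)


data Grounded : ℕ → Colour → List CPart → Set where
  []  : ∀ {v p} → Grounded v p []
  _∷_ : ∀ {v p x r π} → 1 ≤ x × x ≡ diff p r + v → Grounded x r π → Grounded v p ((x , r) ∷ π)

Grounded⇒groundedFrom : ∀ {v p π} → Grounded v p π → T (groundedFrom v p π)
Grounded⇒groundedFrom [] = _
Grounded⇒groundedFrom {v} {p} (_∷_ {x = x} {r} (1≤x , x≡) g) =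
  Equivalence.from T-∧ (≤⇒≤ᵇ 1≤x , Equivalence.from T-∧
    (≡⇒≡ᵇ x (v + diff p r) (trans x≡ (+-comm (diff p r) v)) , Grounded⇒groundedFrom g))

groundedFrom⇒Grounded : ∀ v p π → T (groundedFrom v p π) → Grounded v p π
groundedFrom⇒Grounded v p []             _ = []
groundedFrom⇒Grounded v p ((x , r) ∷ π) t
  with Equivalence.to T-∧ t
... | 1≤x , t′ with Equivalence.to T-∧ t′
... | x≡ , g = (≤ᵇ⇒≤ 1 x 1≤x , trans (≡ᵇ⇒≡ x _ x≡) (+-comm v (diff p r)))
             ∷ groundedFrom⇒Grounded x r π g

data Outer : Set where
  A C : Outer

outer : Outer → Colour
outer A = a
outer C = c

mirror : Outer → Outer
mirror A = C
mirror C = A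

data Shade (ρ : Outer) : Colour → Set where
  middle   : Shade ρ b
  same     : Shade ρ (outer ρ)
  mirrored : Shade ρ (outer (mirror ρ))

shade : ∀ ρ p → Shade ρ p
shade ρ b = middle
shade A a = same
shade A c = mirrored
shade C a = mirrored
shade C c = same

shade-same : ∀ ρ → shade ρ (outer ρ) ≡ same
shade-same A = refl
shade-same C = refl

shade-mirrored : ∀ ρ → shade ρ (outer (mirror ρ)) ≡ mirrored
shade-mirrored A = refl
shade-mirrored C = refl

diff-outer-b : ∀ ρ → diff (outer ρ) b ≡ 1
diff-outer-b A = refl
diff-outer-b C = refl

diff-b-outer : ∀ ρ → diff b (outer ρ) ≡ 1
diff-b-outer A = refl
diff-b-outer C = refl

diff-same : ∀ ρ → diff (outer ρ) (outer ρ) ≡ 2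
diff-same A = refl
diff-same C = refl

diff-mirrored : ∀ ρ → diff (outer ρ) (outer (mirror ρ)) ≡ 0
diff-mirrored A = refl
diff-mirrored C = refl

-- A code for what lies above an even level v whose last part has the outer colour ρ:
-- `halt j` is j parts (v+1, b); `stay j L r` is j parts (v+1, b), then L+1 parts of size v+2
-- alternating between a and c and starting with ρ, then the code r above level v+2;
-- `turn j L r` is the same with j+1 parts (v+1, b) and a run starting with the other outer colour.
-- `alternate w σ L r` lists the last L parts of a run of size w after a part of colour σ, then r.
data Code : Set where
  halt : ℕ → Code
  stay turn : ℕ → ℕ → Code → Code

mutual
  toGrounded : ℕ → Outer → Code → List CPart
  toGrounded v ρ (halt j)     = replicate j (suc v , b)
  toGrounded v ρ (stay j L r) =
    replicate j (suc v , b) ++ (2 + v , outer ρ) ∷ alternate (2 + v) ρ L r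
  toGrounded v ρ (turn j L r) =
    replicate (suc j) (suc v , b) ++ (2 + v , outer (mirror ρ)) ∷ alternate (2 + v) (mirror ρ) L r

  alternate : ℕ → Outer → ℕ → Code → List CPart
  alternate w σ zero    r = toGrounded w σ r
  alternate w σ (suc L) r = (w , outer (mirror σ)) ∷ alternate w (mirror σ) L r

bump : Code → Code
bump (halt j)     = halt (suc j)
bump (stay j L r) = stay (suc j) L r
bump (turn j L r) = turn (suc j) L r

mutual
  codeOf : Outer → List CPart → Code
  codeOf ρ []            = halt 0
  codeOf ρ ((_ , p) ∷ π) with shade ρ p
  ... | middle   = middleOf ρ π
  ... | same     = uncurry (stay 0) (runOf ρ π)
  ... | mirrored = halt 0 -- a part of size v, impossible in a grounded partition

  middleOf : Outer → List CPart → Code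
  middleOf ρ []            = halt 1
  middleOf ρ ((_ , p) ∷ π) with shade ρ p
  ... | middle   = bump (middleOf ρ π)
  ... | same     = uncurry (stay 1) (runOf ρ π)
  ... | mirrored = uncurry (turn 0) (runOf (mirror ρ) π)

  runOf : Outer → List CPart → ℕ × Code
  runOf σ []                 = 0 , halt 0
  runOf σ ((_ , p) ∷ π) with shade σ p
  ... | middle   = 0 , middleOf σ π
  ... | same     = 0 , uncurry (stay 0) (runOf σ π)
  ... | mirrored = map₁ suc (runOf (mirror σ) π)

runOf-toGrounded : ∀ w σ r → runOf σ (toGrounded w σ r) ≡ (0 , codeOf σ (toGrounded w σ r))
runOf-toGrounded w σ (halt zero)    = refl
runOf-toGrounded w σ (halt (suc j)) = refl
runOf-toGrounded w σ (stay zero L r) rewrite shade-same σ = refl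
runOf-toGrounded w σ (stay (suc j) L r) = refl
runOf-toGrounded w σ (turn j L r)  = refl

middleOf-halt : ∀ w σ j → middleOf σ (replicate j (suc w , b)) ≡ halt (suc j)
middleOf-halt w σ zero    = refl
middleOf-halt w σ (suc j) = cong bump (middleOf-halt w σ j)

mutual
  codeOf-toGrounded : ∀ w σ r → codeOf σ (toGrounded w σ r) ≡ r
  codeOf-toGrounded w σ (halt zero)        = refl
  codeOf-toGrounded w σ (halt (suc j))     = middleOf-halt w σ j
  codeOf-toGrounded w σ (stay zero L r) rewrite shade-same σ =
    cong (uncurry (stay 0)) (runOf-alternate (2 + w) σ L r)
  codeOf-toGrounded w σ (stay (suc j) L r) = middleOf-stay w σ j L r
  codeOf-toGrounded w σ (turn j L r)       = middleOf-turn w σ j L r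

  runOf-alternate : ∀ w σ L r → runOf σ (alternate w σ L r) ≡ (L , r)
  runOf-alternate w σ zero    r =
    trans (runOf-toGrounded w σ r) (cong (0 ,_) (codeOf-toGrounded w σ r))
  runOf-alternate w σ (suc L) r rewrite shade-mirrored σ =
    cong (map₁ suc) (runOf-alternate w (mirror σ) L r)

  middleOf-stay : ∀ w σ j L r →
    middleOf σ (replicate j (suc w , b) ++ (2 + w , outer σ) ∷ alternate (2 + w) σ L r) ≡ stay (suc j) L r
  middleOf-stay w σ zero L r rewrite shade-same σ =
    cong (uncurry (stay 1)) (runOf-alternate (2 + w) σ L r)
  middleOf-stay w σ (suc j) L r = cong bump (middleOf-stay w σ j L r)

  middleOf-turn : ∀ w σ j L r →
    middleOf σ (replicate j (suc w , b) ++ (2 + w , outer (mirror σ)) ∷ alternate (2 + w) (mirror σ) L r)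
      ≡ turn j L r
  middleOf-turn w σ zero L r rewrite shade-mirrored σ =
    cong (uncurry (turn 0)) (runOf-alternate (2 + w) (mirror σ) L r)
  middleOf-turn w σ (suc j) L r = cong bump (middleOf-turn w σ j L r)

toGrounded-injective : ∀ v ρ → Injective _≡_ _≡_ (toGrounded v ρ)
toGrounded-injective v ρ {κ} {κ′} eq =
  trans (sym (codeOf-toGrounded v ρ κ)) (trans (cong (codeOf ρ) eq) (codeOf-toGrounded v ρ κ′))

middles-grounded : ∀ {v π} j → Grounded (suc v) b π → Grounded (suc v) b (replicate j (suc v , b) ++ π)
middles-grounded zero    g = g
middles-grounded (suc j) g = (s≤s z≤n , refl) ∷ middles-grounded j g

mutual
  toGrounded-grounded : ∀ v ρ κ → Grounded v (outer ρ) (toGrounded v ρ κ)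
  toGrounded-grounded v ρ (halt zero)    = []
  toGrounded-grounded v ρ (halt (suc j)) =
    (s≤s z≤n , cong (_+ v) (sym (diff-outer-b ρ))) ∷ subst (Grounded _ b) (++-identityʳ _) (middles-grounded j [])
  toGrounded-grounded v ρ (stay zero L r) =
    (s≤s z≤n , cong (_+ v) (sym (diff-same ρ))) ∷ alternate-grounded v ρ L r
  toGrounded-grounded v ρ (stay (suc j) L r) =
    (s≤s z≤n , cong (_+ v) (sym (diff-outer-b ρ))) ∷ middles-grounded j
      ((s≤s z≤n , cong (_+ suc v) (sym (diff-b-outer ρ))) ∷ alternate-grounded v ρ L r)
  toGrounded-grounded v ρ (turn j L r) =
    (s≤s z≤n , cong (_+ v) (sym (diff-outer-b ρ))) ∷ middles-grounded j
      ((s≤s z≤n , cong (_+ suc v) (sym (diff-b-outer (mirror ρ)))) ∷ alternate-grounded v (mirror ρ) L r)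

  alternate-grounded : ∀ v σ L r → Grounded (2 + v) (outer σ) (alternate (2 + v) σ L r)
  alternate-grounded v σ zero    r = toGrounded-grounded (2 + v) σ r
  alternate-grounded v σ (suc L) r =
    (s≤s z≤n , cong (_+ (2 + v)) (sym (diff-mirrored σ))) ∷ alternate-grounded v (mirror σ) L r

toGrounded-bump : ∀ v ρ κ → toGrounded v ρ (bump κ) ≡ (suc v , b) ∷ toGrounded v ρ κ
toGrounded-bump v ρ (halt j)     = refl
toGrounded-bump v ρ (stay j L r) = refl
toGrounded-bump v ρ (turn j L r) = refl

mutual
  toGrounded-middleOf : ∀ v ρ π → Grounded (suc v) b π → toGrounded v ρ (middleOf ρ π) ≡ (suc v , b) ∷ π
  toGrounded-middleOf v ρ [] [] = refl
  toGrounded-middleOf v ρ ((x , p) ∷ π) ((_ , x≡) ∷ g) with shade ρ p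
  ... | middle rewrite x≡ =
    trans (toGrounded-bump v ρ (middleOf ρ π)) (cong ((suc v , b) ∷_) (toGrounded-middleOf v ρ π g))
  ... | same rewrite trans x≡ (cong (_+ suc v) (diff-b-outer ρ)) =
    cong (λ π′ → (suc v , b) ∷ (2 + v , outer ρ) ∷ π′) (alternate-runOf (2 + v) ρ π g)
  ... | mirrored rewrite trans x≡ (cong (_+ suc v) (diff-b-outer (mirror ρ))) =
    cong (λ π′ → (suc v , b) ∷ (2 + v , outer (mirror ρ)) ∷ π′) (alternate-runOf (2 + v) (mirror ρ) π g)

  alternate-runOf : ∀ w σ π → Grounded w (outer σ) π → uncurry (alternate w σ) (runOf σ π) ≡ π
  alternate-runOf w σ [] [] = refl
  alternate-runOf w σ ((x , p) ∷ π) ((_ , x≡) ∷ g) with shade σ p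
  ... | middle rewrite trans x≡ (cong (_+ w) (diff-outer-b σ)) = toGrounded-middleOf w σ π g
  ... | same rewrite trans x≡ (cong (_+ w) (diff-same σ)) =
    cong ((2 + w , outer σ) ∷_) (alternate-runOf (2 + w) σ π g)
  ... | mirrored rewrite trans x≡ (cong (_+ w) (diff-mirrored σ)) =
    cong ((w , outer (mirror σ)) ∷_) (alternate-runOf w (mirror σ) π g)

toGrounded-codeOf : ∀ π → Grounded 0 a π → toGrounded 0 A (codeOf A π) ≡ π
toGrounded-codeOf []                  []                = refl
toGrounded-codeOf ((x , a) ∷ π) ((_ , refl) ∷ g) = cong ((2 , a) ∷_) (alternate-runOf 2 A π g)
toGrounded-codeOf ((x , b) ∷ π) ((_ , refl) ∷ g) = toGrounded-middleOf 0 A π g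
toGrounded-codeOf ((x , c) ∷ π) (((), refl) ∷ g)


partSizes : ℕ → Code → List ℕ
partSizes v (halt j)     = replicate j (suc v)
partSizes v (stay j L r) = replicate j (suc v) ++ replicate (suc L) (2 + v) ++ partSizes (2 + v) r
partSizes v (turn j L r) = replicate (suc j) (suc v) ++ replicate (suc L) (2 + v) ++ partSizes (2 + v) r

mutual
  sizes-toGrounded : ∀ v ρ κ → sizes (toGrounded v ρ κ) ≡ partSizes v κ
  sizes-toGrounded v ρ (halt j)     = map-replicate proj₁ j _
  sizes-toGrounded v ρ (stay j L r) =
    trans (map-++ proj₁ (replicate j _) _)
          (cong₂ _++_ (map-replicate proj₁ j _) (cong (2 + v ∷_) (sizes-alternate (2 + v) ρ L r)))
  sizes-toGrounded v ρ (turn j L r) =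
    trans (map-++ proj₁ (replicate (suc j) _) _)
          (cong₂ _++_ (map-replicate proj₁ (suc j) _) (cong (2 + v ∷_) (sizes-alternate (2 + v) (mirror ρ) L r)))

  sizes-alternate : ∀ w σ L r → sizes (alternate w σ L r) ≡ replicate L w ++ partSizes w r
  sizes-alternate w σ zero    r = sizes-toGrounded w σ r
  sizes-alternate w σ (suc L) r = cong (w ∷_) (sizes-alternate w (mirror σ) L r)

height : Code → ℕ
height (halt _)     = 0
height (stay _ L r) = suc L + height r
height (turn _ L r) = suc L + height r

evens : ℕ → Code → List ℕ
evens v (halt _)     = []
evens v (stay _ L r) = 2 * (suc L + height r) ∷ evens (2 + v) r
evens v (turn _ L r) = evens (2 + v) r

odds : ℕ → Code → List ℕ
odds v (halt j)     = replicate j (suc v)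
odds v (stay j L r) = odds (2 + v) r ++ replicate j (suc v)
odds v (turn j L r) = 2 * (suc L + height r) + suc v ∷ odds (2 + v) r ++ replicate j (suc v)

sum-layer : ∀ j L v rest →
  sum (replicate j (suc v) ++ replicate (suc L) (2 + v) ++ rest) ≡ j * suc v + (suc L * (2 + v) + sum rest)
sum-layer j L v rest = begin
  sum (replicate j (suc v) ++ replicate (suc L) (2 + v) ++ rest)
    ≡⟨ sum-++ (replicate j (suc v)) _ ⟩
  sum (replicate j (suc v)) + sum (replicate (suc L) (2 + v) ++ rest)
    ≡⟨ cong₂ _+_ (sum-replicate j (suc v)) (sum-++ (replicate (suc L) (2 + v)) rest) ⟩
  j * suc v + (sum (replicate (suc L) (2 + v)) + sum rest)
    ≡⟨ cong (λ s → j * suc v + (s + sum rest)) (sum-replicate (suc L) (2 + v)) ⟩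
  j * suc v + (suc L * (2 + v) + sum rest) ∎
  where open ≡-Reasoning

sum-partSizes : ∀ v κ → sum (partSizes v κ) ≡ sum (evens v κ) + sum (odds v κ) + v * height κ
sum-partSizes v (halt j) = begin
  sum (replicate j (suc v))      ≡⟨ sum-replicate j (suc v) ⟩
  j * suc v                      ≡⟨ +-identityʳ (j * suc v) ⟨
  j * suc v + 0                  ≡⟨ cong (j * suc v +_) (*-zeroʳ v) ⟨
  j * suc v + v * 0              ≡⟨ cong (_+ v * 0) (sum-replicate j (suc v)) ⟨
  sum (replicate j (suc v)) + v * 0 ∎
  where open ≡-Reasoning
sum-partSizes v (stay j L r) = begin
  sum (replicate j (suc v) ++ replicate (suc L) (2 + v) ++ partSizes (2 + v) r)
    ≡⟨ sum-layer j L v (partSizes (2 + v) r) ⟩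
  j * suc v + (suc L * (2 + v) + sum (partSizes (2 + v) r))
    ≡⟨ cong (λ s → j * suc v + (suc L * (2 + v) + s)) (sum-partSizes (2 + v) r) ⟩
  j * suc v + (suc L * (2 + v) + (e + o + (2 + v) * h))
    ≡⟨ regroup j L v e o h ⟩
  2 * (suc L + h) + e + (o + j * suc v) + v * (suc L + h)
    ≡⟨ cong (λ s → 2 * (suc L + h) + e + s + v * (suc L + h)) (sum-++-replicate (odds (2 + v) r) j (suc v)) ⟨
  2 * (suc L + h) + e + sum (odds (2 + v) r ++ replicate j (suc v)) + v * (suc L + h) ∎
  where
  open ≡-Reasoning
  e = sum (evens (2 + v) r)
  o = sum (odds (2 + v) r)
  h = height r
  regroup : ∀ j L v e o h → j * suc v + (suc L * (2 + v) + (e + o + (2 + v) * h))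
                          ≡ 2 * (suc L + h) + e + (o + j * suc v) + v * (suc L + h)
  regroup = solve-∀
sum-partSizes v (turn j L r) = begin
  sum (replicate (suc j) (suc v) ++ replicate (suc L) (2 + v) ++ partSizes (2 + v) r)
    ≡⟨ sum-layer (suc j) L v (partSizes (2 + v) r) ⟩
  suc j * suc v + (suc L * (2 + v) + sum (partSizes (2 + v) r))
    ≡⟨ cong (λ s → suc j * suc v + (suc L * (2 + v) + s)) (sum-partSizes (2 + v) r) ⟩
  suc j * suc v + (suc L * (2 + v) + (e + o + (2 + v) * h))
    ≡⟨ regroup j L v e o h ⟩
  e + (2 * (suc L + h) + suc v + (o + j * suc v)) + v * (suc L + h)
    ≡⟨ cong (λ s → e + (2 * (suc L + h) + suc v + s) + v * (suc L + h)) (sum-++-replicate (odds (2 + v) r) j (suc v)) ⟨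
  e + (2 * (suc L + h) + suc v + sum (odds (2 + v) r ++ replicate j (suc v))) + v * (suc L + h) ∎
  where
  open ≡-Reasoning
  e = sum (evens (2 + v) r)
  o = sum (odds (2 + v) r)
  h = height r
  regroup : ∀ j L v e o h → suc j * suc v + (suc L * (2 + v) + (e + o + (2 + v) * h))
                          ≡ e + (2 * (suc L + h) + suc v + (o + j * suc v)) + v * (suc L + h)
  regroup = solve-∀

countOdd-layer : ∀ v j L rest → isOdd v ≡ false →
  countOdd (replicate j (suc v) ++ replicate L (2 + v) ++ rest) ≡ j + countOdd rest
countOdd-layer v j L rest ev = begin
  countOdd (replicate j (suc v) ++ replicate L (2 + v) ++ rest)
    ≡⟨ countOdd-++ (replicate j (suc v)) _ ⟩
  countOdd (replicate j (suc v)) + countOdd (replicate L (2 + v) ++ rest)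
    ≡⟨ cong₂ _+_ (countOdd-replicate-odd j (cong not ev)) (countOdd-++ (replicate L (2 + v)) rest) ⟩
  j + (countOdd (replicate L (2 + v)) + countOdd rest)
    ≡⟨ cong (λ k → j + (k + countOdd rest)) (countOdd-replicate-even L (trans (isOdd-2+ v) ev)) ⟩
  j + countOdd rest ∎
  where open ≡-Reasoning

mutual
  countOdd-partSizes : ∀ v κ → isOdd v ≡ false → countOdd (partSizes v κ) ≡ length (odds v κ)
  countOdd-partSizes v (halt j) ev =
    trans (countOdd-replicate-odd j (cong not ev)) (sym (length-replicate j))
  countOdd-partSizes v (stay j L r) ev =
    trans (countOdd-layer v j (suc L) (partSizes (2 + v) r) ev) (countOdd-above v j r ev)
  countOdd-partSizes v (turn j L r) ev =
    trans (countOdd-layer v (suc j) (suc L) (partSizes (2 + v) r) ev) (cong suc (countOdd-above v j r ev))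

  countOdd-above : ∀ v j r → isOdd v ≡ false →
    j + countOdd (partSizes (2 + v) r) ≡ length (odds (2 + v) r ++ replicate j (suc v))
  countOdd-above v j r ev = trans (cong (j +_) (countOdd-partSizes (2 + v) r (trans (isOdd-2+ v) ev)))
                                  (length-++-replicate (odds (2 + v) r) j (suc v))


data StrictEvens : List ℕ → Set where
  []  : StrictEvens []
  _∷_ : ∀ {d ds} → isOdd d ≡ false × 1 ≤ d × All (_< d) ds → StrictEvens ds → StrictEvens (d ∷ ds)

data OddsFrom (lo : ℕ) : List ℕ → Set where
  []  : OddsFrom lo []
  _∷_ : ∀ {o os} → isOdd o ≡ true × lo ≤ o × All (_≤ o) os → OddsFrom lo os → OddsFrom lo (o ∷ os)

OddsFrom-lower : ∀ {lo os} → OddsFrom lo os → All (lo ≤_) os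
OddsFrom-lower []                  = []
OddsFrom-lower ((_ , lo≤ , _) ∷ s) = lo≤ ∷ OddsFrom-lower s

OddsFrom-weaken : ∀ {lo lo′ os} → lo ≤ lo′ → OddsFrom lo′ os → OddsFrom lo os
OddsFrom-weaken le []                    = []
OddsFrom-weaken le ((o , lo≤ , ≤o) ∷ s) = (o , ≤-trans le lo≤ , ≤o) ∷ OddsFrom-weaken le s

OddsFrom-++ : ∀ {lo} B {xs ys} → OddsFrom lo xs → OddsFrom lo ys →
              All (B ≤_) xs → All (_≤ B) ys → OddsFrom lo (xs ++ ys)
OddsFrom-++ B []                     t _          _   = t
OddsFrom-++ B ((o , lo≤ , ≤x) ∷ s) t (B≤x ∷ bs) ≤B =
  (o , lo≤ , ++⁺ ≤x (All.map (λ y≤B → ≤-trans y≤B B≤x) ≤B)) ∷ OddsFrom-++ B s t bs ≤B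

OddsFrom-replicate : ∀ {x} n → isOdd x ≡ true → OddsFrom x (replicate n x)
OddsFrom-replicate zero    _ = []
OddsFrom-replicate (suc n) o = (o , ≤-refl , All-replicate n ≤-refl) ∷ OddsFrom-replicate n o

OddsFrom-++-replicate : ∀ {v xs} j → isOdd v ≡ false → OddsFrom (3 + v) xs →
  OddsFrom (suc v) (xs ++ replicate j (suc v))
OddsFrom-++-replicate {v} j ev s =
  OddsFrom-++ (suc v) (OddsFrom-weaken 1+v≤3+v s) (OddsFrom-replicate j (cong not ev))
    (All.map (≤-trans 1+v≤3+v) (OddsFrom-lower s)) (All-replicate j ≤-refl)
  where
  1+v≤3+v : suc v ≤ 3 + v
  1+v≤3+v = ≤-trans (n≤1+n _) (n≤1+n _)

2*-mono-height : ∀ L h → 2 * h < 2 * (suc L + h)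
2*-mono-height L h = *-monoʳ-< 2 (s≤s (m≤n+m h L))

layer-bound : ∀ L h v → 2 * h + (3 + v) ≤ 2 * (suc L + h) + suc v
layer-bound L h v = subst (2 * h + (3 + v) ≤_) (sym (split L h v)) (m≤m+n _ (2 * L))
  where
  split : ∀ L h v → 2 * (suc L + h) + suc v ≡ 2 * h + (3 + v) + 2 * L
  split = solve-∀

evens-bounded : ∀ v κ → All (_≤ 2 * height κ) (evens v κ)
evens-bounded v (halt _)     = []
evens-bounded v (stay _ L r) =
  ≤-refl ∷ All.map (λ x≤ → ≤-trans x≤ (<⇒≤ (2*-mono-height L (height r)))) (evens-bounded (2 + v) r)
evens-bounded v (turn _ L r) =
  All.map (λ x≤ → ≤-trans x≤ (<⇒≤ (2*-mono-height L (height r)))) (evens-bounded (2 + v) r)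

odds-layer-bounded : ∀ v j L r → All (_≤ 2 * height r + (3 + v)) (odds (2 + v) r) →
  All (_≤ 2 * (suc L + height r) + suc v) (odds (2 + v) r ++ replicate j (suc v))
odds-layer-bounded v j L r bounded =
  ++⁺ (All.map (λ x≤ → ≤-trans x≤ (layer-bound L (height r) v)) bounded)
      (All-replicate j (m≤n+m (suc v) (2 * (suc L + height r))))

odds-bounded : ∀ v κ → All (_≤ 2 * height κ + suc v) (odds v κ)
odds-bounded v (halt j)     = All-replicate j ≤-refl
odds-bounded v (stay j L r) = odds-layer-bounded v j L r (odds-bounded (2 + v) r)
odds-bounded v (turn j L r) = ≤-refl ∷ odds-layer-bounded v j L r (odds-bounded (2 + v) r)

evens-strict : ∀ v κ → StrictEvens (evens v κ)
evens-strict v (halt _)     = []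
evens-strict v (stay _ L r) =
  (isOdd-2* (suc L + height r) , s≤s z≤n ,
   All.map (λ x≤ → ≤-<-trans x≤ (2*-mono-height L (height r))) (evens-bounded (2 + v) r))
  ∷ evens-strict (2 + v) r
evens-strict v (turn _ L r) = evens-strict (2 + v) r

odds-from : ∀ v κ → isOdd v ≡ false → OddsFrom (suc v) (odds v κ)
odds-from v (halt j)     ev = OddsFrom-replicate j (cong not ev)
odds-from v (stay j L r) ev = OddsFrom-++-replicate j ev (odds-from (2 + v) r (trans (isOdd-2+ v) ev))
odds-from v (turn j L r) ev =
  (trans (isOdd-2*+ (suc L + height r) (suc v)) (cong not ev) , m≤n+m (suc v) (2 * (suc L + height r)) ,
   odds-layer-bounded v j L r (odds-bounded (2 + v) r))
  ∷ OddsFrom-++-replicate j ev (odds-from (2 + v) r (trans (isOdd-2+ v) ev))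

layer-injective : ∀ L L′ h → 2 * (suc L + h) ≡ 2 * (suc L′ + h) → L ≡ L′
layer-injective L L′ h eq = suc-injective (+-cancelʳ-≡ h (suc L) (suc L′) (*-cancelˡ-≡ _ _ 2 eq))

odds-above : ∀ v r → isOdd v ≡ false → All (suc v <_) (odds (2 + v) r)
odds-above v r ev = All.map (≤-trans (n≤1+n _)) (OddsFrom-lower (odds-from (2 + v) r (trans (isOdd-2+ v) ev)))

stay≢turn : ∀ v j L r j′ L′ r′ →
  evens v (stay j L r) ≡ evens v (turn j′ L′ r′) → odds v (stay j L r) ≡ odds v (turn j′ L′ r′) → ⊥
stay≢turn v j L r j′ L′ r′ eE eO = <-irrefl refl (≤-<-trans top′≤top (≤-<-trans top≤h′ h′<top′))
  where
  top≤h′ : 2 * (suc L + height r) ≤ 2 * height r′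
  top≤h′ = All.head (subst (All (_≤ 2 * height r′)) (sym eE) (evens-bounded (2 + v) r′))
  h′<top′ : 2 * height r′ < 2 * (suc L′ + height r′)
  h′<top′ = 2*-mono-height L′ (height r′)
  top′≤top : 2 * (suc L′ + height r′) ≤ 2 * (suc L + height r)
  top′≤top = +-cancelʳ-≤ (suc v) _ _
    (All.head (subst (All (_≤ 2 * (suc L + height r) + suc v)) eO (odds-bounded v (stay j L r))))

evens-odds-injective : ∀ v κ κ′ → isOdd v ≡ false → evens v κ ≡ evens v κ′ → odds v κ ≡ odds v κ′ → κ ≡ κ′
evens-odds-injective v (halt j) (halt j′) ev eE eO = cong halt (replicate-injective j j′ eO)
evens-odds-injective v (halt j) (stay j′ L′ r′) ev () eO
evens-odds-injective v (stay j L r) (halt j′) ev () eO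
evens-odds-injective v (halt zero) (turn j′ L′ r′) ev eE ()
evens-odds-injective v (halt (suc j)) (turn j′ L′ r′) ev eE eO = ⊥-elim (m≢1+n+m (suc v) (∷-injectiveˡ eO))
evens-odds-injective v (turn j L r) (halt zero) ev eE ()
evens-odds-injective v (turn j L r) (halt (suc j′)) ev eE eO = ⊥-elim (m≢1+n+m (suc v) (sym (∷-injectiveˡ eO)))
evens-odds-injective v (stay j L r) (turn j′ L′ r′) ev eE eO = ⊥-elim (stay≢turn v j L r j′ L′ r′ eE eO)
evens-odds-injective v (turn j L r) (stay j′ L′ r′) ev eE eO = ⊥-elim (stay≢turn v j′ L′ r′ j L r (sym eE) (sym eO))
evens-odds-injective v (stay j L r) (stay j′ L′ r′) ev eE eO
  with oEq , refl ← ++-replicate-injective _ _ j j′ (odds-above v r ev) (odds-above v r′ ev) eO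
  with refl ← evens-odds-injective (2 + v) r r′ (trans (isOdd-2+ v) ev) (∷-injectiveʳ eE) oEq
  = cong (λ L → stay j L r) (layer-injective L L′ (height r) (∷-injectiveˡ eE))
evens-odds-injective v (turn j L r) (turn j′ L′ r′) ev eE eO
  with oEq , refl ← ++-replicate-injective _ _ j j′ (odds-above v r ev) (odds-above v r′ ev) (∷-injectiveʳ eO)
  with refl ← evens-odds-injective (2 + v) r r′ (trans (isOdd-2+ v) ev) eE oEq
  = cong (λ L → turn j L r) (layer-injective L L′ (height r) (+-cancelʳ-≡ (suc v) _ _ (∷-injectiveˡ eO)))

split-lowest : ∀ v {O} → isOdd v ≡ false → OddsFrom (suc v) O →
  ∃[ O′ ] ∃[ j ] O ≡ O′ ++ replicate j (suc v) × OddsFrom (3 + v) O′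
split-lowest v ev [] = [] , 0 , refl , []
split-lowest v ev (_∷_ {o} {os} (odd , lo≤ , ≤o) s) with o ≟ suc v
... | yes refl = [] , suc (length os) , cong (suc v ∷_) (All-≤-≥⇒replicate os ≤o (OddsFrom-lower s)) , []
... | no o≢ with split-lowest v ev s
...   | O″ , j , refl , s″ =
  o ∷ O″ , j , refl , (odd , odd-gap (trans odd (sym (cong not ev))) lo≤ (o≢ ∘ sym) , ++⁻ˡ O″ ≤o) ∷ s″

height-< : ∀ w κ {h} → 0 < h → All (_< 2 * h) (evens w κ) → All (_< 2 * h + suc w) (odds w κ) → height κ < h
height-< w (halt _)     0<h _           _           = 0<h
height-< w (stay _ L r) _   (top< ∷ _) _           = *-cancelˡ-< 2 _ _ top<
height-< w (turn _ L r) _   _           (top< ∷ _) = *-cancelˡ-< 2 _ _ (+-cancelʳ-< (suc w) _ _ top<)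

layer-height : ∀ {e h} → e < h → suc (h ∸ suc e) + e ≡ h
layer-height {e} {h} e<h = trans (sym (+-suc (h ∸ suc e) e)) (m∸n+n≡m e<h)

stay-onto : ∀ v j {d D′ O′} → isOdd d ≡ false → 1 ≤ d → All (_< d) D′ → All (_< d + (3 + v)) O′ →
  ∃[ r ] evens (2 + v) r ≡ D′ × odds (2 + v) r ≡ O′ →
  ∃[ κ ] evens v κ ≡ d ∷ D′ × odds v κ ≡ O′ ++ replicate j (suc v)
stay-onto v j {d} even pos <d <top (r , refl , refl) with half d even
... | h , refl =
  stay j (h ∸ suc (height r)) r , cong (λ H → 2 * H ∷ evens (2 + v) r) (layer-height r<h) , refl
  where
  r<h : height r < h
  r<h = height-< (2 + v) r (*-cancelˡ-< 2 0 h pos) <d <top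

turn-onto : ∀ v j {o D O″} → isOdd o ≡ true → isOdd v ≡ false → 3 + v ≤ o →
  All (λ x → x + suc v < o) D → All (_≤ o) O″ →
  ∃[ r ] evens (2 + v) r ≡ D × odds (2 + v) r ≡ O″ →
  ∃[ κ ] evens v κ ≡ D × odds v κ ≡ o ∷ O″ ++ replicate j (suc v)
turn-onto v j {o} odd ev lo <o ≤o (r , refl , refl)
  with half-difference {o} {suc v} (trans odd (sym (cong not ev))) (≤-trans (n≤1+n _) (≤-trans (n≤1+n _) lo))
... | h , refl =
  turn j (h ∸ suc (height r)) r , refl , cong (λ H → 2 * H + suc v ∷ _) (layer-height r<h)
  where
  r<h : height r < h
  r<h = height-< (2 + v) r (*-cancelˡ-< 2 0 h (+-cancelʳ-< (suc v) 0 (2 * h) (≤-trans (n≤1+n _) lo)))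
          (All.map (+-cancelʳ-< (suc v) _ _) <o)
          (All.map (λ x≤ → ≤-<-trans x≤ (+-monoʳ-< (2 * h) (s≤s (s≤s (n≤1+n v))))) ≤o)

-- The argument n bounds the number of parts and only serves termination.
mutual
  evens-odds-onto : ∀ n v {D O} → length D + length O ≤ n → isOdd v ≡ false →
    StrictEvens D → OddsFrom (suc v) O → ∃[ κ ] evens v κ ≡ D × odds v κ ≡ O
  evens-odds-onto n v {D} len ev sD sO with split-lowest v ev sO
  ... | O′ , j , refl , sO′ =
    evens-odds-onto-above n v j (≤-trans (+-monoʳ-≤ (length D) (length-++-≤ˡ O′)) len) ev sD sO′

  evens-odds-onto-above : ∀ n v j {D O′} → length D + length O′ ≤ n → isOdd v ≡ false →
    StrictEvens D → OddsFrom (3 + v) O′ → ∃[ κ ] evens v κ ≡ D × odds v κ ≡ O′ ++ replicate j (suc v)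
  evens-odds-onto-above n v j {[]} {[]} _ _ [] [] = halt j , refl , refl
  evens-odds-onto-above zero v j {d ∷ _} () _ _ _
  evens-odds-onto-above zero v j {[]} {o ∷ _} () _ _ _
  evens-odds-onto-above (suc n) v j {d ∷ D′} {[]} (s≤s len) ev ((even , pos , <d) ∷ sD′) [] =
    stay-onto v j even pos <d [] (evens-odds-onto n (2 + v) len (trans (isOdd-2+ v) ev) sD′ [])
  evens-odds-onto-above (suc n) v j {[]} {o ∷ O″} (s≤s len) ev [] ((odd , lo , ≤o) ∷ sO″) =
    turn-onto v j odd ev lo [] ≤o (evens-odds-onto n (2 + v) len (trans (isOdd-2+ v) ev) [] sO″)
  evens-odds-onto-above (suc n) v j {d ∷ D′} {o ∷ O″} (s≤s len) ev
                        sD@((even , pos , <d) ∷ sD′) sO@((odd , lo , ≤o) ∷ sO″) with o ≤? d + suc v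
  ... | yes o≤ =
    stay-onto v j even pos <d (top< ∷ All.map (λ x≤o → ≤-<-trans x≤o top<) ≤o)
      (evens-odds-onto n (2 + v) len (trans (isOdd-2+ v) ev) sD′ sO)
    where
    top< : o < d + (3 + v)
    top< = ≤-<-trans o≤ (+-monoʳ-< d (s≤s (s≤s (n≤1+n v))))
  ... | no o≰ =
    turn-onto v j odd ev lo (d< ∷ All.map (λ x<d → <-trans (+-monoˡ-< (suc v) x<d) d<) <d) ≤o
      (evens-odds-onto n (2 + v) (subst (_≤ n) (+-suc (length D′) (length O″)) len)
         (trans (isOdd-2+ v) ev) sD sO″)
    where
    d< : d + suc v < o
    d< = ≰⇒> o≰


data EvenDistinctPartition : List ℕ → Set where
  []  : EvenDistinctPartition []
  _∷_ : ∀ {x xs} → 1 ≤ x × All (_≤ x) xs × (isOdd x ≡ false → All (_< x) xs) →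
        EvenDistinctPartition xs → EvenDistinctPartition (x ∷ xs)

evenParts oddParts : List ℕ → List ℕ
evenParts = filterᵇ isEven
oddParts  = filterᵇ isOdd

StrictEvens-even : ∀ {D} → StrictEvens D → All (λ d → isOdd d ≡ false) D
StrictEvens-even []                = []
StrictEvens-even ((even , _) ∷ s) = even ∷ StrictEvens-even s

OddsFrom-odd : ∀ {lo O} → OddsFrom lo O → All (λ o → isOdd o ≡ true) O
OddsFrom-odd []               = []
OddsFrom-odd ((odd , _) ∷ s) = odd ∷ OddsFrom-odd s

merge-EvenDistinctPartition : ∀ D O → StrictEvens D → OddsFrom 1 O → EvenDistinctPartition (merge _≥?_ D O)
merge-EvenDistinctPartition []      O  _ sO = OddsFrom⇒ sO
  where
  OddsFrom⇒ : ∀ {O} → OddsFrom 1 O → EvenDistinctPartition O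
  OddsFrom⇒ []                    = []
  OddsFrom⇒ ((odd , pos , ≤o) ∷ s) = (pos , ≤o , λ even → ⊥-elim (true⇒≢false odd even)) ∷ OddsFrom⇒ s
merge-EvenDistinctPartition (d ∷ D) [] sD _ = StrictEvens⇒ sD
  where
  StrictEvens⇒ : ∀ {D} → StrictEvens D → EvenDistinctPartition D
  StrictEvens⇒ []                     = []
  StrictEvens⇒ ((_ , pos , <d) ∷ s) = (pos , All.map <⇒≤ <d , λ _ → <d) ∷ StrictEvens⇒ s
merge-EvenDistinctPartition (d ∷ D) (o ∷ O) sD@((even , pos , <d) ∷ sD′) sO@((odd , lo , ≤o) ∷ sO′)
  with o ≤? d | merge-EvenDistinctPartition D (o ∷ O) sD′ sO | merge-EvenDistinctPartition (d ∷ D) O sD sO′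
... | yes o≤d | ih | _ = subst EvenDistinctPartition (sym (merge-≥ D O o≤d))
  ((pos , All-merge _≥?_ (All.map <⇒≤ <d) (o≤d ∷ All.map (λ x≤o → ≤-trans x≤o o≤d) ≤o) ,
    λ _ → All-merge _≥?_ <d (o<d ∷ All.map (λ x≤o → ≤-<-trans x≤o o<d) ≤o)) ∷ ih)
  where
  o<d : o < d
  o<d = ≤∧≢⇒< o≤d (odd≢even odd even)
... | no o≰d | _ | ih = subst EvenDistinctPartition (sym (merge-< D O d<o))
  ((lo , All-merge _≥?_ (<⇒≤ d<o ∷ All.map (λ x<d → <⇒≤ (<-trans x<d d<o)) <d) ≤o ,
    λ even → ⊥-elim (true⇒≢false odd even)) ∷ ih)
  where
  d<o : d < o
  d<o = ≰⇒> o≰d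

evenParts-strict : ∀ {μ} → EvenDistinctPartition μ → StrictEvens (evenParts μ)
evenParts-strict [] = []
evenParts-strict (_∷_ {x} (pos , _ , strict) e) with isOdd x in even
... | true  = evenParts-strict e
... | false = (even , pos , filter⁺ _ (strict refl)) ∷ evenParts-strict e

oddParts-from : ∀ {μ} → EvenDistinctPartition μ → OddsFrom 1 (oddParts μ)
oddParts-from [] = []
oddParts-from (_∷_ {x} (pos , ≤x , _) e) with isOdd x in odd
... | true  = (odd , pos , filter⁺ _ ≤x) ∷ oddParts-from e
... | false = oddParts-from e

evenParts-below : ∀ {x} xs → isOdd x ≡ true → All (_≤ x) xs → All (_< x) (evenParts xs)
evenParts-below []       _   []          = []
evenParts-below (y ∷ ys) odd (y≤x ∷ ≤x) with isOdd y in parity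
... | true  = evenParts-below ys odd ≤x
... | false = ≤∧≢⇒< y≤x (odd≢even odd parity ∘ sym) ∷ evenParts-below ys odd ≤x

merge-parts : ∀ {μ} → EvenDistinctPartition μ → merge _≥?_ (evenParts μ) (oddParts μ) ≡ μ
merge-parts [] = refl
merge-parts (_∷_ {x} {xs} (_ , ≤x , _) e) with isOdd x in parity
... | true  = trans (merge-<-all (evenParts xs) (oddParts xs) (evenParts-below xs parity ≤x))
                    (cong (x ∷_) (merge-parts e))
... | false = trans (merge-≥-all (evenParts xs) (oddParts xs) (filter⁺ _ ≤x))
                    (cong (x ∷_) (merge-parts e))

occurs-below : ∀ {x} xs → All (_< x) xs → occurs x xs ≡ false
occurs-below []       []          = refl
occurs-below {x} (y ∷ ys) (y<x ∷ <x) with x ≡ᵇ y in eq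
... | true  = ⊥-elim (<-irrefl (sym (≡ᵇ⇒≡ x y (true⇒T eq))) y<x)
... | false = occurs-below ys <x

occurs-absent : ∀ {x} xs → occurs x xs ≡ false → All (_≢ x) xs
occurs-absent []       _ = []
occurs-absent {x} (y ∷ ys) o with x ≡ᵇ y in eq
... | false = (λ y≡x → false⇒¬T eq (≡⇒≡ᵇ x y (sym y≡x))) ∷ occurs-absent ys o

EvenDistinctPartition⇒allPositive : ∀ {μ} → EvenDistinctPartition μ → allPositive μ ≡ true
EvenDistinctPartition⇒allPositive []              = refl
EvenDistinctPartition⇒allPositive ((pos , _) ∷ e) =
  cong₂ _∧_ (≤⇒≤ᵇ≡true pos) (EvenDistinctPartition⇒allPositive e)

EvenDistinctPartition⇒nonIncreasing : ∀ {μ} → EvenDistinctPartition μ → nonIncreasing μ ≡ true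
EvenDistinctPartition⇒nonIncreasing []                                = refl
EvenDistinctPartition⇒nonIncreasing (_ ∷ [])                          = refl
EvenDistinctPartition⇒nonIncreasing ((_ , y≤x ∷ _ , _) ∷ e@(_ ∷ _)) =
  cong₂ _∧_ (≤⇒≤ᵇ≡true y≤x) (EvenDistinctPartition⇒nonIncreasing e)

EvenDistinctPartition⇒evenDistinct : ∀ {μ} → EvenDistinctPartition μ → evenDistinct μ ≡ true
EvenDistinctPartition⇒evenDistinct [] = refl
EvenDistinctPartition⇒evenDistinct (_∷_ {x} {xs} (_ , _ , strict) e) with isEven x in even
... | true  =
  cong₂ _∧_ (cong not (occurs-below xs (strict (not-injective even)))) (EvenDistinctPartition⇒evenDistinct e)
... | false = EvenDistinctPartition⇒evenDistinct e

nonIncreasing-tail : ∀ x xs → nonIncreasing (x ∷ xs) ≡ true → nonIncreasing xs ≡ true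
nonIncreasing-tail x []       _  = refl
nonIncreasing-tail x (y ∷ ys) ni = ∧-conicalʳ _ _ ni

nonIncreasing-head : ∀ x xs → nonIncreasing (x ∷ xs) ≡ true → EvenDistinctPartition xs → All (_≤ x) xs
nonIncreasing-head x []       _  []               = []
nonIncreasing-head x (y ∷ ys) ni ((_ , ≤y , _) ∷ _) = y≤x ∷ All.map (λ z≤y → ≤-trans z≤y y≤x) ≤y
  where
  y≤x : y ≤ x
  y≤x = ≤ᵇ⇒≤ y x (true⇒T (∧-conicalˡ _ _ ni))

evenDistinct-tail : ∀ x xs → evenDistinct (x ∷ xs) ≡ true → evenDistinct xs ≡ true
evenDistinct-tail x xs ed with isEven x
... | true  = ∧-conicalʳ _ _ ed
... | false = ed

evenDistinct-head : ∀ x xs → evenDistinct (x ∷ xs) ≡ true → isOdd x ≡ false → occurs x xs ≡ false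
evenDistinct-head x xs ed even with isEven x in even′
... | true  = not-injective (∧-conicalˡ _ _ ed)
... | false = ⊥-elim (true⇒≢false (cong not even) even′)

EvenDistinctPartition-from : ∀ μ → allPositive μ ≡ true → nonIncreasing μ ≡ true → evenDistinct μ ≡ true →
  EvenDistinctPartition μ
EvenDistinctPartition-from []       _   _  _  = []
EvenDistinctPartition-from (x ∷ xs) pos ni ed = (1≤x , ≤x , strict) ∷ e
  where
  e = EvenDistinctPartition-from xs (∧-conicalʳ _ _ pos) (nonIncreasing-tail x xs ni) (evenDistinct-tail x xs ed)
  1≤x : 1 ≤ x
  1≤x = ≤ᵇ⇒≤ 1 x (true⇒T (∧-conicalˡ _ _ pos))
  ≤x : All (_≤ x) xs
  ≤x = nonIncreasing-head x xs ni e
  strict : isOdd x ≡ false → All (_< x) xs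
  strict even = All.zipWith (uncurry ≤∧≢⇒<) (≤x , occurs-absent xs (evenDistinct-head x xs ed even))


toE : Code → List ℕ
toE κ = merge _≥?_ (evens 0 κ) (odds 0 κ)

evenParts-toE : ∀ κ → evenParts (toE κ) ≡ evens 0 κ
evenParts-toE κ = filterᵇ-merge-left isEven _≥?_ (evens 0 κ) (odds 0 κ)
  (All.map (cong not) (StrictEvens-even (evens-strict 0 κ)))
  (All.map (cong not) (OddsFrom-odd (odds-from 0 κ refl)))

oddParts-toE : ∀ κ → oddParts (toE κ) ≡ odds 0 κ
oddParts-toE κ = filterᵇ-merge-right isOdd _≥?_ (evens 0 κ) (odds 0 κ)
  (StrictEvens-even (evens-strict 0 κ)) (OddsFrom-odd (odds-from 0 κ refl))

toE-injective : Injective _≡_ _≡_ toE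
toE-injective {κ} {κ′} eq = evens-odds-injective 0 κ κ′ refl
  (trans (sym (evenParts-toE κ)) (trans (cong evenParts eq) (evenParts-toE κ′)))
  (trans (sym (oddParts-toE κ)) (trans (cong oddParts eq) (oddParts-toE κ′)))

toE-EvenDistinctPartition : ∀ κ → EvenDistinctPartition (toE κ)
toE-EvenDistinctPartition κ =
  merge-EvenDistinctPartition (evens 0 κ) (odds 0 κ) (evens-strict 0 κ) (odds-from 0 κ refl)

toE-onto : ∀ {μ} → EvenDistinctPartition μ → ∃[ κ ] toE κ ≡ μ
toE-onto e with evens-odds-onto _ 0 ≤-refl refl (evenParts-strict e) (oddParts-from e)
... | κ , eE , eO = κ , trans (cong₂ (merge _≥?_) eE eO) (merge-parts e)

sum-toGrounded : ∀ κ → sum (sizes (toGrounded 0 A κ)) ≡ sum (toE κ)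
sum-toGrounded κ = begin
  sum (sizes (toGrounded 0 A κ))            ≡⟨ cong sum (sizes-toGrounded 0 A κ) ⟩
  sum (partSizes 0 κ)                       ≡⟨ sum-partSizes 0 κ ⟩
  sum (evens 0 κ) + sum (odds 0 κ) + 0      ≡⟨ +-identityʳ _ ⟩
  sum (evens 0 κ) + sum (odds 0 κ)          ≡⟨ sum-merge _≥?_ (evens 0 κ) (odds 0 κ) ⟨
  sum (toE κ)                               ∎
  where open ≡-Reasoning

countOdd-toGrounded : ∀ κ → countOdd (sizes (toGrounded 0 A κ)) ≡ countOdd (toE κ)
countOdd-toGrounded κ = begin
  countOdd (sizes (toGrounded 0 A κ))       ≡⟨ cong countOdd (sizes-toGrounded 0 A κ) ⟩
  countOdd (partSizes 0 κ)                  ≡⟨ countOdd-partSizes 0 κ refl ⟩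
  length (odds 0 κ)                         ≡⟨ cong length (oddParts-toE κ) ⟨
  length (oddParts (toE κ))                 ≡⟨ countOdd≡length-filter (toE κ) ⟨
  countOdd (toE κ)                          ∎
  where open ≡-Reasoning

isGrounded-toGrounded : ∀ κ → isGrounded (toGrounded 0 A κ) ≡ true
isGrounded-toGrounded κ = Equivalence.to T-≡ (Grounded⇒groundedFrom (toGrounded-grounded 0 A κ))

isGrounded⇒code : ∀ π → isGrounded π ≡ true → ∃[ κ ] toGrounded 0 A κ ≡ π
isGrounded⇒code π g = codeOf A π , toGrounded-codeOf π (groundedFrom⇒Grounded 0 a π (true⇒T g))

isPartition-toE : ∀ κ → isPartition (toE κ) ≡ true
isPartition-toE κ = cong₂ _∧_ (EvenDistinctPartition⇒allPositive (toE-EvenDistinctPartition κ))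
                              (EvenDistinctPartition⇒nonIncreasing (toE-EvenDistinctPartition κ))

evenDistinct-toE : ∀ κ → evenDistinct (toE κ) ≡ true
evenDistinct-toE κ = EvenDistinctPartition⇒evenDistinct (toE-EvenDistinctPartition κ)

partition⇒code : ∀ μ → isPartition μ ≡ true → evenDistinct μ ≡ true → ∃[ κ ] toE κ ≡ μ
partition⇒code μ ip ed = toE-onto (EvenDistinctPartition-from μ (∧-conicalˡ _ _ ip) (∧-conicalʳ _ _ ip) ed)

theorem1p15 : (n k : ℕ) → k ≤ n → Pa n k ↔ E n k
theorem1p15 n k _ =
  ↔-trans (↔-sym (image-↔ (toGrounded 0 A) (toGrounded-injective 0 A) (λ {π} → Pa-irrelevant π)
                           (λ {π} (g , _) → isGrounded⇒code π g)))
  (↔-trans (Σ-⇔-↔ (λ {κ} → Pa-irrelevant (toGrounded 0 A κ)) (λ {κ} → E-irrelevant (toE κ)) same-statistics)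
           (image-↔ toE toE-injective (λ {μ} → E-irrelevant μ) (λ {μ} (ip , ed , _) → partition⇒code μ ip ed)))
  where
  Pa-irrelevant : ∀ π → Irrelevant ((isGrounded π ≡ true) × (sum (sizes π) ≡ n) × (countOdd (sizes π) ≡ k))
  Pa-irrelevant _ = ×-irrelevant Bool-≡-irrelevant (×-irrelevant ≡-irrelevant ≡-irrelevant)
  E-irrelevant : ∀ μ → Irrelevant ((isPartition μ ≡ true) × (evenDistinct μ ≡ true) × (sum μ ≡ n) × (countOdd μ ≡ k))
  E-irrelevant _ = ×-irrelevant Bool-≡-irrelevant (×-irrelevant Bool-≡-irrelevant (×-irrelevant ≡-irrelevant ≡-irrelevant))
  same-statistics : ∀ κ →
    ((isGrounded (toGrounded 0 A κ) ≡ true) × (sum (sizes (toGrounded 0 A κ)) ≡ n) × (countOdd (sizes (toGrounded 0 A κ)) ≡ k)) ⇔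
    ((isPartition (toE κ) ≡ true) × (evenDistinct (toE κ) ≡ true) × (sum (toE κ) ≡ n) × (countOdd (toE κ) ≡ k))
  same-statistics κ = mk⇔
    (λ (_ , s , o) → isPartition-toE κ , evenDistinct-toE κ ,
                     trans (sym (sum-toGrounded κ)) s , trans (sym (countOdd-toGrounded κ)) o)
    (λ (_ , _ , s , o) → isGrounded-toGrounded κ , trans (sum-toGrounded κ) s , trans (countOdd-toGrounded κ) o)
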